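{- A quiver $Q$ is acyclic if and only if $Q$ admits a maximal green sequence of length $|Q_0|$.
   Context: A quiver is a finite directed graph with vertex set $Q_0=[n]$ and no loops or oriented 2-cycles; it is acyclic if it has no oriented cycles. Mutation $\mu_k$ at a vertex $k$: (1) for every path $i\to k\to j$ add an arrow $i\to j$; (2) reverse all arrows incident to $k$; (3) remove a maximal collection of oriented 2-cycles, and remove arrows between two frozen vertices. The framed quiver $\widehat Q$ has additional frozen vertices $i'$ ($i\in[n]$) and arrows $i\to i'$; only vertices in $[n]$ are mutated. In a quiver obtained from $\widehat Q$ by mutations, a mutable vertex $i$ is green if there is no arrow $j'\to i$ from a frozen vertex and red if there is no arrow $i\to j'$ to a frozen vertex. A maximal green sequence of $Q$ is a sequence $(i_1,\dots,i_r)$ of mutable vertices such that each $i_j$ is green in $\mu_{i_{j-1}}\cdots\mu_{i_1}(\widehat Q)$ and all mutable vertices are red in $\mu_{i_r}\cdots\mu_{i_1}(\widehat Q)$; its length is $r$. -}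

module Defs where

open import Data.Nat using (ℕ; zero; suc; _+_; _*_; _∸_; _<_)
open import Data.Fin using (Fin)
open import Data.Fin.Properties using () renaming (_≟_ to _≟ᶠ_)
open import Data.Sum using (_⊎_; inj₁; inj₂)
open import Data.List using (List; []; _∷_)
open import Data.Product using (_×_)
open import Relation.Binary.PropositionalEquality using (_≡_)
open import Relation.Nullary using (¬_; yes; no)

record Quiver (n : ℕ) : Set where
  field
    arrows   : Fin n → Fin n → ℕ
    noLoop   : ∀ i → arrows i i ≡ 0
    no2cycle : ∀ i j → arrows i j ≡ 0 ⊎ arrows j i ≡ 0
open Quiver public

data Path {V : Set} (a : V → V → ℕ) : V → V → Set where
  edge : ∀ {i j} → 0 < a i j → Path a i j
  step : ∀ {i j k} → 0 < a i j → Path a j k → Path a i k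

Acyclic : ∀ {n} → Quiver n → Set
Acyclic Q = ∀ i → ¬ Path (arrows Q) i i

-- Vertices of a framed quiver: inj₁ i is the mutable vertex i,
-- inj₂ i is the frozen vertex i'.
FVert : ℕ → Set
FVert n = Fin n ⊎ Fin n

FQuiver : ℕ → Set
FQuiver n = FVert n → FVert n → ℕ

_≟ᵛ_ : ∀ {n} (x y : FVert n) → Relation.Nullary.Dec (x ≡ y)
inj₁ i ≟ᵛ inj₁ j with i ≟ᶠ j
... | yes Relation.Binary.PropositionalEquality.refl = yes Relation.Binary.PropositionalEquality.refl
... | no ne = no λ { Relation.Binary.PropositionalEquality.refl → ne Relation.Binary.PropositionalEquality.refl }
inj₁ i ≟ᵛ inj₂ j = no λ ()
inj₂ i ≟ᵛ inj₁ j = no λ ()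
inj₂ i ≟ᵛ inj₂ j with i ≟ᶠ j
... | yes Relation.Binary.PropositionalEquality.refl = yes Relation.Binary.PropositionalEquality.refl
... | no ne = no λ { Relation.Binary.PropositionalEquality.refl → ne Relation.Binary.PropositionalEquality.refl }

framed : ∀ {n} → Quiver n → FQuiver n
framed Q (inj₁ i) (inj₁ j) = arrows Q i j
framed Q (inj₁ i) (inj₂ j) with i ≟ᶠ j
... | yes _ = 1
... | no  _ = 0
framed Q (inj₂ i) _ = 0

module _ {n : ℕ} (k : Fin n) (a : FQuiver n) where
  private
    K : FVert n
    K = inj₁ k

  mutStep1 : FQuiver n
  mutStep1 i j = a i j + a i K * a K j

  mutStep2 : FQuiver n
  mutStep2 i j with i ≟ᵛ K | j ≟ᵛ K
  ... | yes _ | _     = mutStep1 j i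
  ... | no  _ | yes _ = mutStep1 j i
  ... | no  _ | no  _ = mutStep1 i j

  -- (3) remove a maximal collection of oriented 2-cycles,
  --     and remove arrows between two frozen vertices
  mutate : FQuiver n
  mutate (inj₂ _) (inj₂ _) = 0
  mutate i j = mutStep2 i j ∸ mutStep2 j i

Green : ∀ {n} → FQuiver n → Fin n → Set
Green a i = ∀ j → a (inj₂ j) (inj₁ i) ≡ 0

Red : ∀ {n} → FQuiver n → Fin n → Set
Red a i = ∀ j → a (inj₁ i) (inj₂ j) ≡ 0

AllRed : ∀ {n} → FQuiver n → Set
AllRed a = ∀ i → Red a i

IsMaxGreenFrom : ∀ {n} → FQuiver n → List (Fin n) → Set
IsMaxGreenFrom a []       = AllRed a
IsMaxGreenFrom a (k ∷ ks) = Green a k × IsMaxGreenFrom (mutate k a) ks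

IsMaximalGreenSequence : ∀ {n} → Quiver n → List (Fin n) → Set
IsMaximalGreenSequence Q ks = IsMaxGreenFrom (framed Q) ks

module Submission where

-- Both conditions are equivalent to the existence of a SOURCE
-- ORDERING: a duplicate-free list of all vertices in which no vertex receives
-- an arrow from a vertex listed after it.
--
--  * Graph theory: an acyclic quiver admits a source ordering (repeatedly
--    remove a source, which exists by the pigeonhole principle), and a quiver
--    with a source ordering is acyclic (arrows increase the position).
--  * Forward: mutating along a source ordering only ever mutates at a source
--    of the current quiver; such a mutation just reverses the arrows at k,
--    turns k red, and keeps every not-yet-mutated vertex green.
--  * Backward: the frame arrow u → u′ survives until u is mutated, so a
--    maximal green sequence mutates every vertex; if it has length n it is
--    duplicate-free.  If a vertex k were mutated while an arrow x → k with x
--    pending existed, the reversed arrow k → x could never be removed without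
--    leaving a non-red vertex, so such a sequence is a source ordering.

open import Defs
open import Data.Nat using (ℕ; zero; suc; _+_; _*_; _∸_; _≤_; _<_; z≤n; s≤s; s≤s⁻¹)
open import Data.Nat.Properties
  using (≤-total; ≤-refl; ≤-trans; ≤-antisym; <-trans; <-irrefl; n<1+n;
         m≤n⇒m∸n≡0; n∸n≡0; 0∸n≡0; m∸n+n≡m; +-suc; +-identityʳ; *-zeroʳ; *-identityʳ;
         m+n≡0⇒m≡0; m+n≡0⇒n≡0; n≢0⇒n>0; +-monoʳ-<)
  renaming (_≟_ to _≟ℕ_)
open import Data.Fin using (Fin; toℕ) renaming (_<_ to _<ᶠ_)
open import Data.Fin.Properties using (_≟_; pigeonhole; injective⇒≤)
open import Data.List using (List; []; _∷_; _++_; [_]; length; lookup; allFin; filter)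
open import Data.List.Properties using (length-++; ++-assoc; filter-notAll)
open import Data.List.Membership.Propositional using (_∈_; _∉_; find)
open import Data.List.Membership.Propositional.Properties
  using (∈-lookup; ∈-allFin; ∈-++⁺ˡ; ∈-++⁺ʳ; ∈-++⁻; ∈-filter⁺; ∈-filter⁻)
open import Data.List.Relation.Unary.Any as Any using (here; there; index; any?)
open import Data.List.Relation.Unary.Any.Properties using (lookup-index)
open import Data.List.Relation.Unary.All as All using (All; all?)
open import Data.List.Relation.Unary.All.Properties using (¬Any⇒All¬; ¬All⇒Any¬)
open import Data.Product using (∃; Σ; _×_; _,_; proj₁; proj₂)
open import Data.Sum using (_⊎_; inj₁; inj₂)
open import Data.Empty using (⊥-elim)
open import Data.Unit using (⊤; tt)
open import Relation.Nullary using (¬_; yes; no; Dec; ¬?)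
open import Relation.Binary.PropositionalEquality
  using (_≡_; _≢_; refl; sym; trans; cong; subst; subst₂)
open import Function.Bundles using (_⇔_; mk⇔)

-- Truncated subtraction in both directions: one of the two vanishes.  This is
-- why step (3) of mutation never leaves an oriented 2-cycle behind.
∸-either-zero : ∀ p q → p ∸ q ≡ 0 ⊎ q ∸ p ≡ 0
∸-either-zero p q with ≤-total p q
... | inj₁ p≤q = inj₁ (m≤n⇒m∸n≡0 p≤q)
... | inj₂ q≤p = inj₂ (m≤n⇒m∸n≡0 q≤p)

Distinct : ∀ {n} → List (Fin n) → Set
Distinct []       = ⊤
Distinct (k ∷ ks) = k ∉ ks × Distinct ks

Covers : ∀ {n} → List (Fin n) → Set
Covers {n} L = (y : Fin n) → y ∈ L

∈-tail : ∀ {n} {y k : Fin n} {L} → y ∈ k ∷ L → y ≢ k → y ∈ L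
∈-tail (here y≡k) y≢k = ⊥-elim (y≢k y≡k)
∈-tail (there y∈L) _  = y∈L

lookup-injective : ∀ {n} (L : List (Fin n)) → Distinct L → ∀ i j → lookup L i ≡ lookup L j → i ≡ j
lookup-injective (k ∷ L) d         Fin.zero    Fin.zero    e = refl
lookup-injective (k ∷ L) (k∉L , d) Fin.zero    (Fin.suc j) e = ⊥-elim (k∉L (subst (_∈ L) (sym e) (∈-lookup j)))
lookup-injective (k ∷ L) (k∉L , d) (Fin.suc i) Fin.zero    e = ⊥-elim (k∉L (subst (_∈ L) e (∈-lookup i)))
lookup-injective (k ∷ L) (k∉L , d) (Fin.suc i) (Fin.suc j) e = cong Fin.suc (lookup-injective L d i j e)

distinct⇒length≤ : ∀ {n} (L : List (Fin n)) → Distinct L → length L ≤ n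
distinct⇒length≤ L d = injective⇒≤ (λ {i} {j} → lookup-injective L d i j)

covers⇒n≤length : ∀ {n} (L : List (Fin n)) → Covers L → n ≤ length L
covers⇒n≤length L cov = injective⇒≤ {f = λ y → index (cov y)} λ {y} {y′} e →
  trans (lookup-index (cov y)) (trans (cong (lookup L) e) (sym (lookup-index (cov y′))))

-- Suffixes of a list of length n containing every vertex are duplicate-free:
-- a repetition in L could be deleted, giving a shorter list that still
-- contains every vertex.
covers-suffix-distinct : ∀ {n} (E L : List (Fin n)) → Covers (E ++ L) → length (E ++ L) ≡ n → Distinct L
covers-suffix-distinct E []      cov len = tt
covers-suffix-distinct {n} E (x ∷ L) cov len = x∉L , covers-suffix-distinct (E ++ [ x ]) L cov′ len′
  where
  shifted : (E ++ [ x ]) ++ L ≡ E ++ x ∷ L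
  shifted = ++-assoc E [ x ] L
  cov′ : Covers ((E ++ [ x ]) ++ L)
  cov′ y = subst (y ∈_) (sym shifted) (cov y)
  len′ : length ((E ++ [ x ]) ++ L) ≡ n
  len′ = trans (cong length shifted) len
  x∉L : x ∉ L
  x∉L x∈L = <-irrefl refl (≤-trans shorter (covers⇒n≤length (E ++ L) without-x))
    where
    without-x : Covers (E ++ L)
    without-x y with ∈-++⁻ E (cov y)
    ... | inj₁ y∈E         = ∈-++⁺ˡ y∈E
    ... | inj₂ (here refl) = ∈-++⁺ʳ E x∈L
    ... | inj₂ (there y∈L) = ∈-++⁺ʳ E y∈L
    shorter : length (E ++ L) < n
    shorter = subst (length (E ++ L) <_) len
      (subst₂ _<_ (sym (length-++ E)) (sym (length-++ E)) (+-monoʳ-< (length E) (n<1+n _)))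

covers⇒distinct : ∀ {n} (L : List (Fin n)) → Covers L → length L ≡ n → Distinct L
covers⇒distinct = covers-suffix-distinct []

remove : ∀ {n} → Fin n → List (Fin n) → List (Fin n)
remove s = filter (λ z → ¬? (z ≟ s))

remove-shorter : ∀ {n} {s : Fin n} {R} → s ∈ R → length (remove s R) < length R
remove-shorter {s = s} {R} s∈ = filter-notAll (λ z → ¬? (z ≟ s)) R (Any.map (λ s≡z z≢s → z≢s (sym s≡z)) s∈)

module SourceOrderings {n : ℕ} (Q : Quiver n) where

  SourceOrdering : List (Fin n) → Set
  SourceOrdering []       = ⊤
  SourceOrdering (k ∷ ks) = (∀ x → x ∈ ks → arrows Q x k ≡ 0) × SourceOrdering ks

  position : Fin n → List (Fin n) → ℕ
  position x []       = 0
  position x (k ∷ L) with x ≟ k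
  ... | yes _ = 0
  ... | no  _ = suc (position x L)

  arrow-increases-position : ∀ L → SourceOrdering L → ∀ {x u} → x ∈ L → u ∈ L →
                             0 < arrows Q x u → position x L < position u L
  arrow-increases-position (k ∷ L) (k-src , ord) {x} {u} x∈ u∈ x→u with x ≟ k | u ≟ k
  ... | yes refl | yes refl = ⊥-elim (<-irrefl (sym (noLoop Q x)) x→u)
  ... | yes refl | no  _    = s≤s z≤n
  ... | no  x≢k  | yes refl = ⊥-elim (<-irrefl (sym (k-src x (∈-tail x∈ x≢k))) x→u)
  ... | no  x≢k  | no  u≢k  = s≤s (arrow-increases-position L ord (∈-tail x∈ x≢k) (∈-tail u∈ u≢k) x→u)

  path-increases-position : ∀ L → Covers L → SourceOrdering L → ∀ {x y} →
                            Path (arrows Q) x y → position x L < position y L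
  path-increases-position L cov ord (edge x→y)   = arrow-increases-position L ord (cov _) (cov _) x→y
  path-increases-position L cov ord (step x→z p) =
    <-trans (arrow-increases-position L ord (cov _) (cov _) x→z) (path-increases-position L cov ord p)

  sourceOrdering⇒acyclic : ∀ L → Covers L → SourceOrdering L → Acyclic Q
  sourceOrdering⇒acyclic L cov ord i cycle = <-irrefl refl (path-increases-position L cov ord cycle)

  SourceIn : List (Fin n) → Fin n → Set
  SourceIn R s = All (λ z → arrows Q z s ≡ 0) R

  -- If no vertex of R is a source in R, following arrows backwards inside R
  -- for n steps revisits a vertex, which closes an oriented cycle.
  no-source⇒cycle : ∀ R {v} → v ∈ R → (∀ s → s ∈ R → ∃ λ z → z ∈ R × arrows Q z s ≢ 0) →
                    ∃ λ i → Path (arrows Q) i i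
  no-source⇒cycle R {v} v∈R pred = close (pigeonhole (n<1+n n) (λ i → w (toℕ i)))
    where
    backwards : ℕ → Σ (Fin n) (_∈ R)
    backwards zero    = v , v∈R
    backwards (suc t) = let (z , z∈R , _) = pred _ (proj₂ (backwards t)) in z , z∈R
    w : ℕ → Fin n
    w t = proj₁ (backwards t)
    arrow : ∀ t → 0 < arrows Q (w (suc t)) (w t)
    arrow t = n≢0⇒n>0 (proj₂ (proj₂ (pred _ (proj₂ (backwards t)))))
    path : ∀ d t → Path (arrows Q) (w (suc d + t)) (w t)
    path zero    t = edge (arrow t)
    path (suc d) t = step (arrow (suc d + t)) (path d t)
    close : (∃ λ i → ∃ λ j → i <ᶠ j × w (toℕ i) ≡ w (toℕ j)) → ∃ λ x → Path (arrows Q) x x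
    close (i , j , i<j , same) =
      w (toℕ i) , subst (λ y → Path (arrows Q) y (w (toℕ i))) back (path (toℕ j ∸ suc (toℕ i)) (toℕ i))
      where
      back : w (suc ((toℕ j ∸ suc (toℕ i)) + toℕ i)) ≡ w (toℕ i)
      back = trans (cong w (trans (sym (+-suc _ (toℕ i))) (m∸n+n≡m i<j))) (sym same)

  acyclic⇒source : Acyclic Q → ∀ R {v} → v ∈ R → ∃ λ s → s ∈ R × SourceIn R s
  acyclic⇒source acyc R v∈R with any? (λ s → all? (λ z → arrows Q z s ≟ℕ 0) R) R
  ... | yes some = find some
  ... | no none  = ⊥-elim (acyc _ (proj₂ (no-source⇒cycle R v∈R pred)))
    where
    pred : ∀ s → s ∈ R → ∃ λ z → z ∈ R × arrows Q z s ≢ 0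
    pred s s∈R = find (¬All⇒Any¬ (λ z → arrows Q z s ≟ℕ 0) R (All.lookup (¬Any⇒All¬ R none) s∈R))

  SortingOf : List (Fin n) → List (Fin n) → Set
  SortingOf R ks = Distinct ks × (∀ x → x ∈ ks → x ∈ R) × (∀ x → x ∈ R → x ∈ ks) × SourceOrdering ks

  source-∷-sorting : ∀ {R s ks} → s ∈ R → SourceIn R s → SortingOf (remove s R) ks → SortingOf R (s ∷ ks)
  source-∷-sorting {R} {s} {ks} s∈ s-src (dist , ks⊆ , ⊆ks , ord) =
    (s∉ks , dist) , ⊆R , R⊆ , ((λ x x∈ → All.lookup s-src (kept x∈)) , ord)
    where
    kept : ∀ {x} → x ∈ ks → x ∈ R
    kept x∈ = proj₁ (∈-filter⁻ (λ z → ¬? (z ≟ s)) {xs = R} (ks⊆ _ x∈))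
    s∉ks : s ∉ ks
    s∉ks s∈ks = proj₂ (∈-filter⁻ (λ z → ¬? (z ≟ s)) {xs = R} (ks⊆ s s∈ks)) refl
    ⊆R : ∀ x → x ∈ s ∷ ks → x ∈ R
    ⊆R x (here refl) = s∈
    ⊆R x (there x∈)  = kept x∈
    R⊆ : ∀ x → x ∈ R → x ∈ s ∷ ks
    R⊆ x x∈ with x ≟ s
    ... | yes x≡s = here x≡s
    ... | no  x≢s = there (⊆ks x (∈-filter⁺ (λ z → ¬? (z ≟ s)) x∈ x≢s))

  sort : Acyclic Q → (fuel : ℕ) (R : List (Fin n)) → length R ≤ fuel → Σ (List (Fin n)) (SortingOf R)
  sort acyc _          []      _ = [] , tt , (λ _ ()) , (λ _ ()) , tt
  sort acyc (suc fuel) (v ∷ R) (s≤s len)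
    with s , s∈ , s-src ← acyclic⇒source acyc (v ∷ R) (here refl)
    with ks , sorted ← sort acyc fuel (remove s (v ∷ R)) (≤-trans (s≤s⁻¹ (remove-shorter s∈)) len)
    = s ∷ ks , source-∷-sorting s∈ s-src sorted

  acyclic⇒sourceOrdering : Acyclic Q → Σ (List (Fin n)) λ ks → Distinct ks × Covers ks × SourceOrdering ks
  acyclic⇒sourceOrdering acyc with ks , dist , _ , ⊆ks , ord ← sort acyc _ (allFin n) ≤-refl =
    ks , dist , (λ y → ⊆ks y (∈-allFin y)) , ord

record Reduced {n} (a : FQuiver n) : Set where
  field
    loopFree          : ∀ x → a (inj₁ x) (inj₁ x) ≡ 0
    twoCycleFree      : ∀ x y → a (inj₁ x) (inj₁ y) ≡ 0 ⊎ a (inj₁ y) (inj₁ x) ≡ 0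
    frameTwoCycleFree : ∀ x j → a (inj₁ x) (inj₂ j) ≡ 0 ⊎ a (inj₂ j) (inj₁ x) ≡ 0
open Reduced

framed-reduced : ∀ {n} (Q : Quiver n) → Reduced (framed Q)
framed-reduced Q = record
  { loopFree = noLoop Q ; twoCycleFree = no2cycle Q ; frameTwoCycleFree = λ _ _ → inj₂ refl }

mutate-reduced : ∀ {n} (k : Fin n) (a : FQuiver n) → Reduced (mutate k a)
mutate-reduced k a = record
  { loopFree          = λ x → n∸n≡0 (μ (inj₁ x) (inj₁ x))
  ; twoCycleFree      = λ x y → ∸-either-zero (μ (inj₁ x) (inj₁ y)) (μ (inj₁ y) (inj₁ x))
  ; frameTwoCycleFree = λ x j → ∸-either-zero (μ (inj₁ x) (inj₂ j)) (μ (inj₂ j) (inj₁ x))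
  }
  where
  μ = mutStep2 k a

module MutationAt {n : ℕ} (k : Fin n) (a : FQuiver n) where
  K : FVert n
  K = inj₁ k

  private
    step2-from-k : ∀ y → mutStep2 k a K y ≡ mutStep1 k a y K
    step2-from-k y with K ≟ᵛ K
    ... | yes _  = refl
    ... | no K≢K = ⊥-elim (K≢K refl)

    step2-into-k : ∀ x → mutStep2 k a x K ≡ mutStep1 k a K x
    step2-into-k x with x ≟ᵛ K | K ≟ᵛ K
    ... | yes _ | _      = refl
    ... | no _  | yes _  = refl
    ... | no _  | no K≢K = ⊥-elim (K≢K refl)

    step2-away : ∀ x y → x ≢ K → y ≢ K → mutStep2 k a x y ≡ mutStep1 k a x y
    step2-away x y x≢K y≢K with x ≟ᵛ K | y ≟ᵛ K
    ... | yes x≡K | _       = ⊥-elim (x≢K x≡K)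
    ... | no _    | yes y≡K = ⊥-elim (y≢K y≡K)
    ... | no _    | no _    = refl

  mutate-away : ∀ x y → inj₁ x ≢ K → y ≢ K →
                mutate k a (inj₁ x) y ≡ mutStep1 k a (inj₁ x) y ∸ mutStep1 k a y (inj₁ x)
  mutate-away x y x≢K y≢K rewrite step2-away (inj₁ x) y x≢K y≢K | step2-away y (inj₁ x) y≢K x≢K = refl

  mutate-frozen-away : ∀ j x → inj₁ x ≢ K →
                       mutate k a (inj₂ j) (inj₁ x) ≡ mutStep1 k a (inj₂ j) (inj₁ x) ∸ mutStep1 k a (inj₁ x) (inj₂ j)
  mutate-frozen-away j x x≢K
    rewrite step2-away (inj₂ j) (inj₁ x) (λ ()) x≢K | step2-away (inj₁ x) (inj₂ j) x≢K (λ ()) = refl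

  mutate-from-k : ∀ y → mutate k a K y ≡ mutStep1 k a y K ∸ mutStep1 k a K y
  mutate-from-k y rewrite step2-from-k y | step2-into-k y = refl

  mutate-into-k : ∀ y → mutate k a y K ≡ mutStep1 k a K y ∸ mutStep1 k a y K
  mutate-into-k (inj₁ x) rewrite step2-into-k (inj₁ x) | step2-from-k (inj₁ x) = refl
  mutate-into-k (inj₂ j) rewrite step2-into-k (inj₂ j) | step2-from-k (inj₂ j) = refl

  mutate-reverses-into-k : Reduced a → ∀ x → a (inj₁ x) K ≢ 0 → mutate k a K (inj₁ x) ≡ a (inj₁ x) K
  mutate-reverses-into-k red x x→k with twoCycleFree red k x
  ... | inj₂ k↛x = ⊥-elim (x→k k↛x)
  ... | inj₁ k↛x rewrite mutate-from-k (inj₁ x) | loopFree red k | k↛x | *-zeroʳ (a (inj₁ x) K) = +-identityʳ _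

  -- At a source k, step (1) adds nothing, so mutation merely reverses the
  -- arrows at k and cancels 2-cycles elsewhere.
  module AtSource (source : ∀ z → a z K ≡ 0) where
    private
      step1-at-source : ∀ x y → mutStep1 k a x y ≡ a x y
      step1-at-source x y rewrite source x = +-identityʳ _

    source-away : ∀ x y → inj₁ x ≢ K → y ≢ K → mutate k a (inj₁ x) y ≡ a (inj₁ x) y ∸ a y (inj₁ x)
    source-away x y x≢K y≢K
      rewrite mutate-away x y x≢K y≢K | step1-at-source (inj₁ x) y | step1-at-source y (inj₁ x) = refl

    source-frozen-away : ∀ j x → inj₁ x ≢ K →
                         mutate k a (inj₂ j) (inj₁ x) ≡ a (inj₂ j) (inj₁ x) ∸ a (inj₁ x) (inj₂ j)
    source-frozen-away j x x≢K
      rewrite mutate-frozen-away j x x≢K | step1-at-source (inj₂ j) (inj₁ x) | step1-at-source (inj₁ x) (inj₂ j) = refl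

    source-from-k : ∀ y → mutate k a K y ≡ 0
    source-from-k y rewrite mutate-from-k y | step1-at-source y K | step1-at-source K y | source y = 0∸n≡0 (a K y)

    source-into-k : ∀ y → mutate k a y K ≡ a K y
    source-into-k y rewrite mutate-into-k y | step1-at-source K y | step1-at-source y K | source y = refl

record FrameIntact {n} (a : FQuiver n) (u : Fin n) : Set where
  field
    frameArrow  : a (inj₁ u) (inj₂ u) ≡ 1
    noOtherInto : ∀ x → x ≢ u → a (inj₁ x) (inj₂ u) ≡ 0
    noArrowOut  : ∀ x → a (inj₂ u) (inj₁ x) ≡ 0
open FrameIntact

framed-frameIntact : ∀ {n} (Q : Quiver n) u → FrameIntact (framed Q) u
framed-frameIntact Q u = record { frameArrow = diagonal ; noOtherInto = off-diagonal ; noArrowOut = λ _ → refl }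
  where
  diagonal : framed Q (inj₁ u) (inj₂ u) ≡ 1
  diagonal with u ≟ u
  ... | yes _  = refl
  ... | no u≢u = ⊥-elim (u≢u refl)
  off-diagonal : ∀ x → x ≢ u → framed Q (inj₁ x) (inj₂ u) ≡ 0
  off-diagonal x x≢u with x ≟ u
  ... | yes x≡u = ⊥-elim (x≢u x≡u)
  ... | no _    = refl

-- Mutation at another vertex k leaves an intact frame intact: every path
-- through k that could reach or leave u′ would need an arrow k → u′ or u′ → k.
mutate-keeps-frame : ∀ {n} (k : Fin n) (a : FQuiver n) {u} → FrameIntact a u → k ≢ u → FrameIntact (mutate k a) u
mutate-keeps-frame k a {u} intact k≢u =
  record { frameArrow = frame-arrow ; noOtherInto = λ x x≢u → into x x≢u (x ≟ k) ; noArrowOut = λ x → out x (x ≟ k) }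
  where
  open MutationAt k a
  u≢K : inj₁ u ≢ K
  u≢K refl = k≢u refl
  frame-arrow : mutate k a (inj₁ u) (inj₂ u) ≡ 1
  frame-arrow rewrite mutate-away u (inj₂ u) u≢K (λ ()) | frameArrow intact | noOtherInto intact k k≢u
                    | noArrowOut intact u | noArrowOut intact k | *-zeroʳ (a (inj₁ u) K) = refl
  into : ∀ x → x ≢ u → Dec (x ≡ k) → mutate k a (inj₁ x) (inj₂ u) ≡ 0
  into x x≢u (yes refl) rewrite mutate-from-k (inj₂ u) | noArrowOut intact k = 0∸n≡0 (mutStep1 k a K (inj₂ u))
  into x x≢u (no x≢k) rewrite mutate-away x (inj₂ u) (λ { refl → x≢k refl }) (λ ()) | noOtherInto intact x x≢u
                            | noOtherInto intact k k≢u | *-zeroʳ (a (inj₁ x) K) = 0∸n≡0 (mutStep1 k a (inj₂ u) (inj₁ x))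
  out : ∀ x → Dec (x ≡ k) → mutate k a (inj₂ u) (inj₁ x) ≡ 0
  out x (yes refl) rewrite mutate-into-k (inj₂ u) | noOtherInto intact k k≢u | *-zeroʳ (a K K) =
    0∸n≡0 (mutStep1 k a (inj₂ u) K)
  out x (no x≢k) rewrite mutate-frozen-away u x (λ { refl → x≢k refl }) | noArrowOut intact x | noArrowOut intact k =
    0∸n≡0 (mutStep1 k a (inj₁ x) (inj₂ u))

-- The frame of a vertex m after m was mutated at a source: nothing points
-- into m′ and m′ points to no mutable vertex other than m.
record FrameFlipped {n} (a : FQuiver n) (m : Fin n) : Set where
  field
    nothingInto : ∀ x → a (inj₁ x) (inj₂ m) ≡ 0
    onlyOut     : ∀ x → x ≢ m → a (inj₂ m) (inj₁ x) ≡ 0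
open FrameFlipped

module _ {n : ℕ} {k : Fin n} {a : FQuiver n} (source : ∀ z → a z (inj₁ k) ≡ 0) where
  open MutationAt k a
  open AtSource source

  source-flips-frame : FrameIntact a k → FrameFlipped (mutate k a) k
  source-flips-frame intact = record { nothingInto = λ x → into x (x ≟ k) ; onlyOut = out }
    where
    into : ∀ x → Dec (x ≡ k) → mutate k a (inj₁ x) (inj₂ k) ≡ 0
    into x (yes refl) = source-from-k (inj₂ k)
    into x (no x≢k) rewrite source-away x (inj₂ k) (λ { refl → x≢k refl }) (λ ()) | noOtherInto intact x x≢k =
      0∸n≡0 (a (inj₂ k) (inj₁ x))
    out : ∀ x → x ≢ k → mutate k a (inj₂ k) (inj₁ x) ≡ 0
    out x x≢k rewrite source-frozen-away k x (λ { refl → x≢k refl }) | noArrowOut intact x =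
      0∸n≡0 (a (inj₁ x) (inj₂ k))

  source-keeps-flipped : ∀ {m} → m ≢ k → FrameFlipped a m → FrameFlipped (mutate k a) m
  source-keeps-flipped {m} m≢k flipped =
    record { nothingInto = λ x → into x (x ≟ k) ; onlyOut = λ x x≢m → out x x≢m (x ≟ k) }
    where
    into : ∀ x → Dec (x ≡ k) → mutate k a (inj₁ x) (inj₂ m) ≡ 0
    into x (yes refl) = source-from-k (inj₂ m)
    into x (no x≢k) rewrite source-away x (inj₂ m) (λ { refl → x≢k refl }) (λ ()) | nothingInto flipped x =
      0∸n≡0 (a (inj₂ m) (inj₁ x))
    out : ∀ x → x ≢ m → Dec (x ≡ k) → mutate k a (inj₂ m) (inj₁ x) ≡ 0
    out x x≢m (yes refl) = trans (source-into-k (inj₂ m)) (nothingInto flipped k)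
    out x x≢m (no x≢k) rewrite source-frozen-away m x (λ { refl → x≢k refl }) | onlyOut flipped x x≢m =
      0∸n≡0 (a (inj₁ x) (inj₂ m))

-- Mutating at a green vertex w ≠ m keeps an arrow m → j′: step (1) only adds
-- arrows m → j′, and the reverse arrows j′ → m and j′ → w that could cancel
-- them are absent (reducedness, greenness).
green-mutation-keeps-nonRed : ∀ {n} {a : FQuiver n} {w m j} → Reduced a → Green a w → m ≢ w →
                              a (inj₁ m) (inj₂ j) ≢ 0 → mutate w a (inj₁ m) (inj₂ j) ≢ 0
green-mutation-keeps-nonRed {a = a} {w} {m} {j} red green m≢w m→j′ = kept
  where
  open MutationAt w a
  j′↛m : a (inj₂ j) (inj₁ m) ≡ 0
  j′↛m with frameTwoCycleFree red m j
  ... | inj₁ m↛j′ = ⊥-elim (m→j′ m↛j′)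
  ... | inj₂ j′↛m = j′↛m
  kept : mutate w a (inj₁ m) (inj₂ j) ≢ 0
  kept rewrite mutate-away m (inj₂ j) (λ { refl → m≢w refl }) (λ ()) | j′↛m | green j =
    λ e → m→j′ (m+n≡0⇒m≡0 _ e)

-- A non-red vertex that is never mutated again stays non-red, so the
-- sequence cannot end with all vertices red.
nonRed-blocks : ∀ {n} R (a : FQuiver n) {m j} → Reduced a → m ∉ R → a (inj₁ m) (inj₂ j) ≢ 0 → ¬ IsMaxGreenFrom a R
nonRed-blocks []      a _   _  m→j′ allRed = m→j′ (allRed _ _)
nonRed-blocks (w ∷ R) a red m∉ m→j′ (green , rest) =
  nonRed-blocks R (mutate w a) (mutate-reduced w a) (λ m∈R → m∉ (there m∈R))
    (green-mutation-keeps-nonRed red green (λ m≡w → m∉ (here m≡w)) m→j′) rest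

intact-frame⇒mutated : ∀ {n} R (a : FQuiver n) {u} → FrameIntact a u → IsMaxGreenFrom a R → u ∈ R
intact-frame⇒mutated []      a intact allRed with () ← trans (sym (frameArrow intact)) (allRed _ _)
intact-frame⇒mutated (k ∷ R) a {u} intact (_ , rest) with k ≟ u
... | yes k≡u = here (sym k≡u)
... | no  k≢u = there (intact-frame⇒mutated R (mutate k a) (mutate-keeps-frame k a intact k≢u) rest)

pending-frames-after : ∀ {n} {a : FQuiver n} {w R} → (∀ v → v ∈ w ∷ R → FrameIntact a v) → w ∉ R →
                       ∀ v → v ∈ R → FrameIntact (mutate w a) v
pending-frames-after {a = a} {w} intact w∉R v v∈R =
  mutate-keeps-frame w a (intact v (there v∈R)) (λ { refl → w∉R v∈R })

mutation-creates-frame-arrow : ∀ {n} {a : FQuiver n} {w m} → FrameIntact a w → m ≢ w →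
                               a (inj₁ m) (inj₁ w) ≢ 0 → mutate w a (inj₁ m) (inj₂ w) ≢ 0
mutation-creates-frame-arrow {a = a} {w} {m} intact m≢w m→w
  rewrite MutationAt.mutate-away w a m (inj₂ w) (λ { refl → m≢w refl }) (λ ())
        | frameArrow intact | noArrowOut intact m | noArrowOut intact w | *-identityʳ (a (inj₁ m) (inj₁ w)) =
  λ e → m→w (m+n≡0⇒n≡0 _ e)

mutation-keeps-arrow : ∀ {n} {a : FQuiver n} {w m u} → Reduced a → m ≢ w → u ≢ w →
                       a (inj₁ m) (inj₁ w) ≡ 0 → a (inj₁ u) (inj₁ w) ≡ 0 →
                       a (inj₁ m) (inj₁ u) ≢ 0 → mutate w a (inj₁ m) (inj₁ u) ≢ 0
mutation-keeps-arrow {a = a} {w} {m} {u} red m≢w u≢w m↛w u↛w m→u = kept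
  where
  u↛m : a (inj₁ u) (inj₁ m) ≡ 0
  u↛m with twoCycleFree red m u
  ... | inj₁ m↛u = ⊥-elim (m→u m↛u)
  ... | inj₂ u↛m = u↛m
  kept : mutate w a (inj₁ m) (inj₁ u) ≢ 0
  kept rewrite MutationAt.mutate-away w a m (inj₁ u) (λ { refl → m≢w refl }) (λ { refl → u≢w refl })
             | m↛w | u↛w | u↛m | +-identityʳ (a (inj₁ m) (inj₁ u)) = m→u

-- An arrow from a vertex m that is never mutated again to a vertex u that is
-- still to be mutated blocks the sequence.  Look at the next mutation, at w:
-- if m → w, the new arrow m → w′ keeps m non-red; if u → w, the reversed
-- arrow w → u is a new such arrow, now from w; otherwise m → u survives.
doneToPending-blocks : ∀ {n} R (a : FQuiver n) {m u} → Reduced a → (∀ v → v ∈ R → FrameIntact a v) →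
                       Distinct R → m ∉ R → u ∈ R → a (inj₁ m) (inj₁ u) ≢ 0 → ¬ IsMaxGreenFrom a R
doneToPending-blocks (w ∷ R) a {m} {u} red intact (w∉R , distinct) m∉ u∈ m→u (green , rest)
  with a (inj₁ m) (inj₁ w) ≟ℕ 0 | a (inj₁ u) (inj₁ w) ≟ℕ 0 | u ≟ w
... | no m→w | _ | _ =
  nonRed-blocks R (mutate w a) (mutate-reduced w a) (λ m∈R → m∉ (there m∈R))
    (mutation-creates-frame-arrow (intact w (here refl)) (λ m≡w → m∉ (here m≡w)) m→w) rest
... | yes m↛w | _ | yes refl = m→u m↛w
... | yes _ | no u→w | no u≢w =
  doneToPending-blocks R (mutate w a) (mutate-reduced w a) (pending-frames-after intact w∉R) distinct w∉R
    (∈-tail u∈ u≢w) w→u rest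
  where
  w→u : mutate w a (inj₁ w) (inj₁ u) ≢ 0
  w→u e = u→w (trans (sym (MutationAt.mutate-reverses-into-k w a red u u→w)) e)
... | yes m↛w | yes u↛w | no u≢w =
  doneToPending-blocks R (mutate w a) (mutate-reduced w a) (pending-frames-after intact w∉R) distinct
    (λ m∈R → m∉ (there m∈R)) (∈-tail u∈ u≢w)
    (mutation-keeps-arrow red (λ m≡w → m∉ (here m≡w)) u≢w m↛w u↛w m→u) rest

module GreenSequences {n : ℕ} (Q : Quiver n) where
  open SourceOrderings Q
  open import Data.List.Membership.DecPropositional (_≟_ {n}) using (_∈?_)

  AgreesOn : FQuiver n → List (Fin n) → Set
  AgreesOn a R = ∀ x y → x ∈ R → y ∈ R → a (inj₁ x) (inj₁ y) ≡ arrows Q x y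

  NoArrowIntoFrom : FQuiver n → List (Fin n) → Set
  NoArrowIntoFrom a R = ∀ m u → m ∉ R → u ∈ R → a (inj₁ m) (inj₁ u) ≡ 0

  green⇒source : ∀ {a k R} → Reduced a → Green a k → AgreesOn a (k ∷ R) → NoArrowIntoFrom a (k ∷ R) →
                 (∀ x → x ∈ R → arrows Q x k ≡ 0) → ∀ z → a z (inj₁ k) ≡ 0
  green⇒source _ green _ _ _ (inj₂ j) = green j
  green⇒source {a} {k} {R} red green agree sep k-src (inj₁ x) with x ≟ k | x ∈? R
  ... | yes refl | _       = loopFree red x
  ... | no  _    | yes x∈R = trans (agree x k (there x∈R) (here refl)) (k-src x x∈R)
  ... | no  x≢k  | no  x∉R = sep x k (λ { (here x≡k) → x≢k x≡k ; (there x∈R) → x∉R x∈R }) (here refl)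

  module SourceStep {a : FQuiver n} {k : Fin n} {R : List (Fin n)} (k∉R : k ∉ R)
                    (source : ∀ z → a z (inj₁ k) ≡ 0) where
    open MutationAt k a
    open AtSource source

    private
      ≢K : ∀ {x} → x ∈ R → inj₁ x ≢ K
      ≢K x∈R refl = k∉R x∈R

    agrees-after : AgreesOn a (k ∷ R) → AgreesOn (mutate k a) R
    agrees-after agree x y x∈R y∈R
      rewrite source-away x (inj₁ y) (≢K x∈R) (≢K y∈R)
            | agree x y (there x∈R) (there y∈R) | agree y x (there y∈R) (there x∈R)
      with no2cycle Q x y
    ... | inj₁ x↛y rewrite x↛y = 0∸n≡0 (arrows Q y x)
    ... | inj₂ y↛x rewrite y↛x = refl

    noArrowIntoFrom-after : NoArrowIntoFrom a (k ∷ R) → NoArrowIntoFrom (mutate k a) R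
    noArrowIntoFrom-after sep m u m∉R u∈R = by-cases (m ≟ k)
      where
      by-cases : Dec (m ≡ k) → mutate k a (inj₁ m) (inj₁ u) ≡ 0
      by-cases (yes refl) = source-from-k (inj₁ u)
      by-cases (no m≢k) rewrite source-away m (inj₁ u) (λ { refl → m≢k refl }) (≢K u∈R)
                              | sep m u (λ { (here m≡k) → m≢k m≡k ; (there m∈R) → m∉R m∈R }) (there u∈R) =
        0∸n≡0 (a (inj₁ u) (inj₁ m))

  sourceOrdering⇒maxGreen : ∀ R (a : FQuiver n) → Reduced a → (∀ u → u ∈ R → FrameIntact a u) →
                            (∀ m → m ∉ R → FrameFlipped a m) → AgreesOn a R → NoArrowIntoFrom a R →
                            Distinct R → SourceOrdering R → IsMaxGreenFrom a R
  sourceOrdering⇒maxGreen [] a _ _ flipped _ _ _ _ i j = nothingInto (flipped j (λ ())) i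
  sourceOrdering⇒maxGreen (k ∷ R) a red intact flipped agree sep (k∉R , distinct) (k-src , ordering) =
    green , sourceOrdering⇒maxGreen R (mutate k a) (mutate-reduced k a) (pending-frames-after intact k∉R)
              flipped′ (agrees-after agree) (noArrowIntoFrom-after sep) distinct ordering
    where
    green : Green a k
    green j with j ∈? k ∷ R
    ... | yes j∈ = noArrowOut (intact j j∈) k
    ... | no  j∉ = onlyOut (flipped j j∉) k (λ k≡j → j∉ (here (sym k≡j)))
    source : ∀ z → a z (inj₁ k) ≡ 0
    source = green⇒source red green agree sep k-src
    open SourceStep {a = a} k∉R source
    flipped′ : ∀ m → m ∉ R → FrameFlipped (mutate k a) m
    flipped′ m m∉R with m ≟ k
    ... | yes refl = source-flips-frame source (intact k (here refl))
    ... | no  m≢k  = source-keeps-flipped source m≢k (flipped m λ { (here m≡k) → m≢k m≡k ; (there m∈R) → m∉R m∈R })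

  -- Backward direction: a duplicate-free maximal green sequence is a source
  -- ordering, since an arrow x → k with x mutated after k would be reversed
  -- into an arrow from the done vertex k to the pending vertex x.
  maxGreen⇒sourceOrdering : ∀ R (a : FQuiver n) → IsMaxGreenFrom a R → Reduced a →
                            (∀ u → u ∈ R → FrameIntact a u) → AgreesOn a R → NoArrowIntoFrom a R →
                            Distinct R → SourceOrdering R
  maxGreen⇒sourceOrdering []      a _ _ _ _ _ _ = tt
  maxGreen⇒sourceOrdering (k ∷ R) a (green , rest) red intact agree sep (k∉R , distinct) =
    k-src , maxGreen⇒sourceOrdering R (mutate k a) rest (mutate-reduced k a) intact′
              (agrees-after agree) (noArrowIntoFrom-after sep) distinct
    where
    intact′ : ∀ v → v ∈ R → FrameIntact (mutate k a) v
    intact′ = pending-frames-after intact k∉R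
    k-src : ∀ x → x ∈ R → arrows Q x k ≡ 0
    k-src x x∈R with arrows Q x k ≟ℕ 0
    ... | yes x↛k = x↛k
    ... | no  x→k = ⊥-elim (doneToPending-blocks R (mutate k a) (mutate-reduced k a) intact′ distinct k∉R x∈R k→x rest)
      where
      x→k′ : a (inj₁ x) (inj₁ k) ≢ 0
      x→k′ e = x→k (trans (sym (agree x k (there x∈R) (here refl))) e)
      k→x : mutate k a (inj₁ k) (inj₁ x) ≢ 0
      k→x e = x→k′ (trans (sym (MutationAt.mutate-reverses-into-k k a red x x→k′)) e)
    open SourceStep {a = a} k∉R (green⇒source red green agree sep k-src)

  sourceOrdering⇒maximalGreenSequence : ∀ ks → Distinct ks → Covers ks → SourceOrdering ks →
                                        IsMaximalGreenSequence Q ks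
  sourceOrdering⇒maximalGreenSequence ks distinct cov ordering =
    sourceOrdering⇒maxGreen ks (framed Q) (framed-reduced Q) (λ u _ → framed-frameIntact Q u)
      (λ m m∉ → ⊥-elim (m∉ (cov m))) (λ _ _ _ _ → refl) (λ m _ m∉ _ → ⊥-elim (m∉ (cov m))) distinct ordering

  maximalGreenSequence-covers : ∀ ks → IsMaximalGreenSequence Q ks → Covers ks
  maximalGreenSequence-covers ks mgs u = intact-frame⇒mutated ks (framed Q) (framed-frameIntact Q u) mgs

  maximalGreenSequence⇒sourceOrdering : ∀ ks → IsMaximalGreenSequence Q ks → Distinct ks → SourceOrdering ks
  maximalGreenSequence⇒sourceOrdering ks mgs distinct =
    maxGreen⇒sourceOrdering ks (framed Q) mgs (framed-reduced Q) (λ u _ → framed-frameIntact Q u)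
      (λ _ _ _ _ → refl) (λ m _ m∉ _ → ⊥-elim (m∉ (maximalGreenSequence-covers ks mgs m))) distinct

corollary3p4 : (n : ℕ) (Q : Quiver n) →
    Acyclic Q ⇔ ∃ (λ (ks : List (Fin n)) → IsMaximalGreenSequence Q ks × length ks ≡ n)
corollary3p4 n Q = mk⇔ forward backward
  where
  open SourceOrderings Q
  open GreenSequences Q

  forward : Acyclic Q → ∃ (λ (ks : List (Fin n)) → IsMaximalGreenSequence Q ks × length ks ≡ n)
  forward acyclic with ks , distinct , cov , ordering ← acyclic⇒sourceOrdering acyclic =
    ks , sourceOrdering⇒maximalGreenSequence ks distinct cov ordering ,
    ≤-antisym (distinct⇒length≤ ks distinct) (covers⇒n≤length ks cov)

  backward : ∃ (λ (ks : List (Fin n)) → IsMaximalGreenSequence Q ks × length ks ≡ n) → Acyclic Q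
  backward (ks , mgs , len) = sourceOrdering⇒acyclic ks cov
    (maximalGreenSequence⇒sourceOrdering ks mgs (covers⇒distinct ks cov len))
    where
    cov : Covers ks
    cov = maximalGreenSequence-covers ks mgs
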